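{- Let $A$ be a finite alphabet with involution, let $\mathcal{X}$ be a finite set of variables with involution $X\mapsto \overline{X}$ satisfying $X\neq\overline{X}$ for all $X$, and let $(U,V)$ be an (untyped) equation over the free inverse monoid $\mathrm{FIM}(A)$, i.e. $U,V\in (A\cup\mathcal{X})^*$. For each pair $X,\overline{X}\in\mathcal{X}$ choose a fresh idempotent variable $Z_X$ (with $\overline{Z_X}=Z_X$) and fresh reduced variables $x_X,\overline{x}_X$, and let $\tau$ be the monoid homomorphism fixing the letters of $A$ and mapping $X\mapsto Z_Xx_X$ and $\overline{X}\mapsto \overline{x}_XZ_X$. Then: (1) If $\sigma$ is a solution of $(U,V)$ and, for each $X$, $\sigma(X)=(P,g)\in\mathrm{FIM}(A)$ (with $g$ a reduced word), then setting $\sigma'(Z_X)=(P,1)$ and $\sigma'(x_X)=(\mathrm{pref}(g),g)$ (and $\sigma'(\overline{x}_X)$ the inverse of $\sigma'(x_X)$) defines a solution $\sigma'$ of the typed equation $(\tau(U),\tau(V))$. (2) Conversely, if $\sigma'$ is a solution of $(\tau(U),\tau(V))$ with $\sigma'(Z_X)=(P,1)$ and $\sigma'(x_X)=(\mathrm{pref}(g),g)$, then $\sigma(X)=(P\cup\mathrm{pref}(g),g)$ (and $\sigma(\overline X)$ its inverse) defines a solution of $(U,V)$.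
   Context: An involution on a set is a map $y\mapsto\overline{y}$ with $\overline{\overline{y}}=y$; it is extended to words by $\overline{a_1\cdots a_m}=\overline{a_m}\cdots\overline{a_1}$. $\mathrm{FG}(A)$ denotes the group obtained from $A^*$ by the relations $a\overline{a}=1$ ($a\in A$); its elements are identified with reduced words (words with no factor $a\overline a$), and $\widehat u$ is the reduced form of $u\in A^*$. $\mathrm{pref}(L)$ is the set of prefixes of words in $L$. The free inverse monoid $\mathrm{FIM}(A)$ is the set of pairs $(P,g)$ with $P$ a finite prefix-closed set of reduced words and $g\in P$, with multiplication $(P,g)(Q,h)=(P\cup gQ,gh)$ (products computed in $\mathrm{FG}(A)$), identity $(\{1\},1)$ and inverse $\overline{(P,g)}=(g^{ -1}P,g^{ -1})$. Let $\psi:A^*\to\mathrm{FIM}(A)$ be the monoid homomorphism with $\psi(a)=(\{1,a\},a)$. A solution of an untyped equation $(U,V)$ is a map $\sigma:\mathcal X\to A^*$ (equivalently into $\mathrm{FIM}(A)$) with $\sigma(\overline X)=\overline{\sigma(X)}$, extended to a morphism fixing $A$, such that $\psi(\sigma(U))=\psi(\sigma(V))$. A typed equation is a pair of words over $A\cup\Omega\cup\Gamma$, where $\Omega$ is a set of idempotent variables ($\overline Z=Z$) and $\Gamma$ a set of reduced variables ($\overline x\ne x$); a solution is an involution-respecting map $\sigma$ from $\Omega\cup\Gamma$ to $A^*$ (extended to a morphism fixing $A$) such that $\psi(\sigma(Z))$ is idempotent for every $Z\in\Omega$, $\sigma(x)$ is a reduced word for every $x\in\Gamma$, and $\psi(\sigma(U))=\psi(\sigma(V))$.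 Solutions may equivalently be specified by values in $\mathrm{FIM}(A)$. -}

module Defs where

open import Data.Nat using (ℕ)
open import Data.Fin using (Fin; _≟_)
open import Data.List using (List; []; _∷_; _++_; map; foldr; reverse; inits; concatMap)
open import Data.List.Membership.Propositional using (_∈_)
open import Data.List.Relation.Unary.All using (All)
open import Data.Product using (_×_; _,_; proj₁; proj₂; ∃-syntax)
open import Relation.Binary.PropositionalEquality using (_≡_; _≢_)
open import Relation.Nullary using (yes; no)
open import Function.Bundles using (_⇔_)

-- Alphabet A = Fin n, with an involution ι (assumed involutive in the statement).
-- Words over A are List (Fin n).

module _ {n : ℕ} (ι : Fin n → Fin n) where

  barW : List (Fin n) → List (Fin n)
  barW w = reverse (map ι w)

  data Reduced : List (Fin n) → Set where
    red-[] : Reduced []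
    red-[a] : ∀ a → Reduced (a ∷ [])
    red-∷ : ∀ a b w → b ≢ ι a → Reduced (b ∷ w) → Reduced (a ∷ b ∷ w)

  consRed : Fin n → List (Fin n) → List (Fin n)
  consRed a [] = a ∷ []
  consRed a (b ∷ v) with b ≟ ι a
  ... | yes _ = v
  ... | no _ = a ∷ b ∷ v

  red : List (Fin n) → List (Fin n)
  red [] = []
  red (a ∷ w) = consRed a (red w)

  -- raw elements of FIM(A): a pair (P , g), P a finite set given as a list
  FIMraw : Set
  FIMraw = List (List (Fin n)) × List (Fin n)

  Valid : FIMraw → Set
  Valid (P , g) =
    All Reduced P
    × (∀ u v → (u ++ v) ∈ P → u ∈ P)
    × g ∈ P

  _≈F_ : FIMraw → FIMraw → Set
  (P , g) ≈F (Q , h) = (∀ w → (w ∈ P) ⇔ (w ∈ Q)) × (g ≡ h)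

  _·_ : FIMraw → FIMraw → FIMraw
  (P , g) · (Q , h) = (P ++ map (λ q → red (g ++ q)) Q) , red (g ++ h)

  oneF : FIMraw
  oneF = ([] ∷ []) , []

  invF : FIMraw → FIMraw
  invF (P , g) = map (λ p → red (barW g ++ p)) P , barW g

  Idempotent : FIMraw → Set
  Idempotent e = (e · e) ≈F e

  ψ₁ : Fin n → FIMraw
  ψ₁ a = ([] ∷ (a ∷ []) ∷ []) , (a ∷ [])

  ψ : List (Fin n) → FIMraw
  ψ w = foldr (λ a r → ψ₁ a · r) oneF w

-- Untyped letters: A ∪ 𝒳, with 𝒳 = {X_i , X̄_i | i : Fin m} (fixed-point-free involution X_i ↔ X̄_i)
data Letter (n m : ℕ) : Set where
  ltr  : Fin n → Letter n m
  var  : Fin m → Letter n m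
  varᵇ : Fin m → Letter n m

-- Typed letters for τ: A ∪ Ω ∪ Γ with Ω = {Z_i}, Γ = {x_i , x̄_i}
data TLetter (n m : ℕ) : Set where
  tltr : Fin n → TLetter n m
  Zv   : Fin m → TLetter n m   -- Z_{X_i}  (idempotent, Z̄ = Z)
  xv   : Fin m → TLetter n m
  xvᵇ  : Fin m → TLetter n m

τ₁ : ∀ {n m} → Letter n m → List (TLetter n m)
τ₁ (ltr a) = tltr a ∷ []
τ₁ (var i) = Zv i ∷ xv i ∷ []
τ₁ (varᵇ i) = xvᵇ i ∷ Zv i ∷ []

τ : ∀ {n m} → List (Letter n m) → List (TLetter n m)
τ = concatMap τ₁

module _ {n m : ℕ} (ι : Fin n → Fin n) where

  evalU₁ : (Fin m → FIMraw ι) → Letter n m → FIMraw ι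
  evalU₁ σ (ltr a) = ψ₁ ι a
  evalU₁ σ (var i) = σ i
  evalU₁ σ (varᵇ i) = invF ι (σ i)

  evalU : (Fin m → FIMraw ι) → List (Letter n m) → FIMraw ι
  evalU σ w = foldr (λ l r → _·_ ι (evalU₁ σ l) r) (oneF ι) w

  UntypedSolution : (Fin m → FIMraw ι) → List (Letter n m) → List (Letter n m) → Set
  UntypedSolution σ U V =
    (∀ i → Valid ι (σ i)) × _≈F_ ι (evalU σ U) (evalU σ V)

  evalT₁ : (Fin m → FIMraw ι) → (Fin m → FIMraw ι) → TLetter n m → FIMraw ι
  evalT₁ z x (tltr a) = ψ₁ ι a
  evalT₁ z x (Zv i) = z i
  evalT₁ z x (xv i) = x i
  evalT₁ z x (xvᵇ i) = invF ι (x i)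

  evalT : (Fin m → FIMraw ι) → (Fin m → FIMraw ι) → List (TLetter n m) → FIMraw ι
  evalT z x w = foldr (λ l r → _·_ ι (evalT₁ z x l) r) (oneF ι) w

  TypedSolution : (Fin m → FIMraw ι) → (Fin m → FIMraw ι)
                → List (TLetter n m) → List (TLetter n m) → Set
  TypedSolution z x U V =
    (∀ i → Valid ι (z i))
    × (∀ i → Idempotent ι (z i))
    × (∀ i → ∃[ w ] (Reduced ι w × _≈F_ ι (x i) (ψ ι w)))
    × _≈F_ ι (evalT z x U) (evalT z x V)

-- With g reduced, (P , 1)(pref g , g) = (P ∪ pref g , g) in FIM(A) and
-- (pref g , g)⁻¹(P , 1) = (P ∪ pref g , g)⁻¹.  When (P , g) is an element of
-- FIM(A), P is prefix-closed and contains g, so P ∪ pref g = P.  Hence in both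
-- directions σ(X) = σ′(Z_X) σ′(x_X) and σ(X̄) = σ′(x̄_X) σ′(Z_X), so τ(W)
-- evaluates under σ′ to the value of W under σ, for every word W.

module Submission where

open import Defs
open import Data.Nat using (ℕ)
open import Data.Fin using (Fin; _≟_)
open import Data.List using (List; []; _∷_; _++_; _∷ʳ_; map; inits)
open import Data.List.Properties
  using (++-assoc; ++-identityʳ; map-++; map-∘; map-cong; map-id-local; map-cong-local; unfold-reverse)
open import Data.List.Membership.Propositional using (_∈_)
open import Data.List.Membership.Propositional.Properties
  using (∈-++⁺ˡ; ∈-++⁺ʳ; ∈-++⁻; ∈-map⁺; ∈-map⁻)
open import Data.List.Relation.Unary.Any using (here; there)
open import Data.List.Relation.Unary.All as All using (All)
import Data.List.Relation.Unary.All.Properties as All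
open import Data.List.Relation.Binary.Subset.Propositional using (_⊆_)
open import Data.List.Relation.Binary.Subset.Propositional.Properties using (All-resp-⊇)
open import Data.List.Relation.Binary.BagAndSetEquality as SetEquality
  using (_∼[_]_; set; [_]-Equality; commutativeMonoid; ++-idempotent)
open import Data.Product using (_×_; _,_; proj₁; proj₂; ∃; map₂)
open import Data.Sum using (inj₁; inj₂)
open import Function.Bundles using (Equivalence; mk⇔)
open import Algebra.Bundles using (CommutativeMonoid)
open import Relation.Binary.Bundles using (Setoid)
open import Relation.Binary.PropositionalEquality
  using (_≡_; _≢_; refl; sym; trans; cong; cong₂; subst; module ≡-Reasoning)
open import Relation.Nullary using (yes; no; contradiction)

PrefixClosed : {A : Set} → List (List A) → Set
PrefixClosed P = ∀ u v → (u ++ v) ∈ P → u ∈ P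

module _ {A : Set} where

  private
    module SetEq = Setoid ([ set ]-Equality A)

  ∈-inits⁺ : ∀ (u v : List A) → u ∈ inits (u ++ v)
  ∈-inits⁺ []      v = here refl
  ∈-inits⁺ (a ∷ u) v = there (∈-map⁺ (a ∷_) (∈-inits⁺ u v))

  ∈-inits⁻ : ∀ {u w : List A} → u ∈ inits w → ∃ λ v → u ++ v ≡ w
  ∈-inits⁻ {w = w}     (here refl) = w , refl
  ∈-inits⁻ {w = a ∷ w} (there p) with ∈-map⁻ (a ∷_) {xs = inits w} p
  ... | _ , u∈ , refl = map₂ (cong (a ∷_)) (∈-inits⁻ u∈)

  ∈-inits-self : ∀ (w : List A) → w ∈ inits w
  ∈-inits-self w = subst (λ x → w ∈ inits x) (++-identityʳ w) (∈-inits⁺ w [])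

  inits-prefixClosed : ∀ (w : List A) → PrefixClosed (inits w)
  inits-prefixClosed w u v p with ∈-inits⁻ p
  ... | v′ , refl = subst (λ x → u ∈ inits x) (sym (++-assoc u v v′)) (∈-inits⁺ u (v ++ v′))

  inits-⊆ : ∀ {P : List (List A)} {g} → PrefixClosed P → g ∈ P → inits g ⊆ P
  inits-⊆ closed g∈P q∈ with ∈-inits⁻ q∈
  ... | v , refl = closed _ v g∈P

  PrefixClosed-++ : ∀ {P Q : List (List A)} → PrefixClosed P → PrefixClosed Q → PrefixClosed (P ++ Q)
  PrefixClosed-++ {P} closedP closedQ u v uv∈ with ∈-++⁻ P uv∈
  ... | inj₁ uv∈P = ∈-++⁺ˡ (closedP u v uv∈P)
  ... | inj₂ uv∈Q = ∈-++⁺ʳ P (closedQ u v uv∈Q)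

  ++-absorbʳ : ∀ {P Q : List A} → Q ⊆ P → (P ++ Q) ∼[ set ] P
  ++-absorbʳ {P} Q⊆P {w} = mk⇔ absorb ∈-++⁺ˡ
    where
    absorb : w ∈ P ++ _ → w ∈ P
    absorb w∈ with ∈-++⁻ P w∈
    ... | inj₁ w∈P = w∈P
    ... | inj₂ w∈Q = Q⊆P w∈Q

  ∷-dup : ∀ {x : A} {xs} → (x ∷ x ∷ xs) ∼[ set ] (x ∷ xs)
  ∷-dup {x} = SetEquality.++-cong (++-idempotent (x ∷ [])) SetEq.refl

module FreeGroup {n : ℕ} (ι : Fin n → Fin n) (ι-involutive : ∀ a → ι (ι a) ≡ a) where

  Reduced-tail : ∀ {a w} → Reduced ι (a ∷ w) → Reduced ι w
  Reduced-tail (red-[a] _)       = red-[]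
  Reduced-tail (red-∷ _ _ _ _ r) = r

  Reduced-++⁻ˡ : ∀ u {v} → Reduced ι (u ++ v) → Reduced ι u
  Reduced-++⁻ˡ []          r                    = red-[]
  Reduced-++⁻ˡ (a ∷ [])    r                    = red-[a] a
  Reduced-++⁻ˡ (a ∷ b ∷ u) (red-∷ _ _ _ b≢ιa r) = red-∷ a b u b≢ιa (Reduced-++⁻ˡ (b ∷ u) r)

  inits-reduced : ∀ {w} → Reduced ι w → All (Reduced ι) (inits w)
  inits-reduced r = All.tabulate λ q∈ →
    let (v , qv≡w) = ∈-inits⁻ q∈ in Reduced-++⁻ˡ _ (subst (Reduced ι) (sym qv≡w) r)

  consRed-reduced : ∀ a {w} → Reduced ι w → Reduced ι (consRed ι a w)
  consRed-reduced a red-[] = red-[a] a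
  consRed-reduced a {b ∷ w} r with b ≟ ι a
  ... | yes _   = Reduced-tail r
  ... | no b≢ιa = red-∷ a b w b≢ιa r

  red-reduced : ∀ w → Reduced ι (red ι w)
  red-reduced []      = red-[]
  red-reduced (a ∷ w) = consRed-reduced a (red-reduced w)

  consRed-∷ : ∀ a {w} → Reduced ι (a ∷ w) → consRed ι a w ≡ a ∷ w
  consRed-∷ a (red-[a] _) = refl
  consRed-∷ a (red-∷ _ b _ b≢ιa _) with b ≟ ι a
  ... | yes b≡ιa = contradiction b≡ιa b≢ιa
  ... | no _     = refl

  red-id : ∀ {w} → Reduced ι w → red ι w ≡ w
  red-id {[]}    _ = refl
  red-id {a ∷ w} r = trans (cong (consRed ι a) (red-id (Reduced-tail r))) (consRed-∷ a r)

  consRed-cancel : ∀ a {w} → Reduced ι w → consRed ι a (consRed ι (ι a) w) ≡ w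
  consRed-cancel a {[]} _ with ι a ≟ ι a
  ... | yes _   = refl
  ... | no ≢ιa = contradiction refl ≢ιa
  consRed-cancel a {c ∷ w} r with c ≟ ι (ι a)
  ... | yes c≡ιιa = subst (λ b → consRed ι b w ≡ c ∷ w) (trans c≡ιιa (ι-involutive a)) (consRed-∷ c r)
  ... | no _ with ι a ≟ ι a
  ...   | yes _   = refl
  ...   | no ≢ιa = contradiction refl ≢ιa

  red-consRed-++ : ∀ a t v → red ι (consRed ι a t ++ v) ≡ consRed ι a (red ι (t ++ v))
  red-consRed-++ a []      v = refl
  red-consRed-++ a (b ∷ t) v with b ≟ ι a
  ... | yes refl = sym (consRed-cancel a (red-reduced (t ++ v)))
  ... | no _     = refl

  red-red-++ : ∀ u v → red ι (red ι u ++ v) ≡ red ι (u ++ v)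
  red-red-++ []      v = refl
  red-red-++ (a ∷ u) v =
    trans (red-consRed-++ a (red ι u) v) (cong (consRed ι a) (red-red-++ u v))

  red-++-red : ∀ u v → red ι (u ++ red ι v) ≡ red ι (u ++ v)
  red-++-red []      v = red-id (red-reduced v)
  red-++-red (a ∷ u) v = cong (consRed ι a) (red-++-red u v)

  red-assoc : ∀ g h k → red ι (g ++ red ι (h ++ k)) ≡ red ι (red ι (g ++ h) ++ k)
  red-assoc g h k = begin
    red ι (g ++ red ι (h ++ k))   ≡⟨ red-++-red g (h ++ k) ⟩
    red ι (g ++ (h ++ k))         ≡⟨ cong (red ι) (sym (++-assoc g h k)) ⟩
    red ι ((g ++ h) ++ k)         ≡⟨ sym (red-red-++ (g ++ h) k) ⟩
    red ι (red ι (g ++ h) ++ k)   ∎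
    where open ≡-Reasoning

  Reduced-∷ʳ : ∀ w {d c} → Reduced ι (w ∷ʳ d) → c ≢ ι d → Reduced ι (w ∷ʳ d ∷ʳ c)
  Reduced-∷ʳ []          {d} {c} _                    c≢ιd = red-∷ d c [] c≢ιd (red-[a] c)
  Reduced-∷ʳ (e ∷ [])    {d}     (red-∷ _ _ _ d≢ιe r) c≢ιd =
    red-∷ e d _ d≢ιe (Reduced-∷ʳ [] r c≢ιd)
  Reduced-∷ʳ (e ∷ f ∷ w)         (red-∷ _ _ _ f≢ιe r) c≢ιd =
    red-∷ e f _ f≢ιe (Reduced-∷ʳ (f ∷ w) r c≢ιd)

  barW-∷ : ∀ a w → barW ι (a ∷ w) ≡ barW ι w ∷ʳ ι a
  barW-∷ a w = unfold-reverse (ι a) (map ι w)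

  barW-reduced : ∀ {w} → Reduced ι w → Reduced ι (barW ι w)
  barW-reduced red-[]                = red-[]
  barW-reduced (red-[a] a)           = red-[a] (ι a)
  barW-reduced (red-∷ a b w b≢ιa r) =
    subst (Reduced ι) (sym bar≡) (Reduced-∷ʳ (barW ι w) bar-tail-reduced ιa≢ιιb)
    where
    bar≡ : barW ι (a ∷ b ∷ w) ≡ barW ι w ∷ʳ ι b ∷ʳ ι a
    bar≡ = trans (barW-∷ a (b ∷ w)) (cong (_∷ʳ ι a) (barW-∷ b w))
    bar-tail-reduced : Reduced ι (barW ι w ∷ʳ ι b)
    bar-tail-reduced = subst (Reduced ι) (barW-∷ b w) (barW-reduced r)
    ιa≢ιιb : ι a ≢ ι (ι b)
    ιa≢ιιb ιa≡ιιb = b≢ιa (sym (trans ιa≡ιιb (ι-involutive b)))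

  red-barW : ∀ {g} → Reduced ι g → red ι (barW ι g ++ []) ≡ barW ι g
  red-barW {g} r = trans (cong (red ι) (++-identityʳ (barW ι g))) (red-id (barW-reduced r))

module FreeInverseMonoid {n : ℕ} (ι : Fin n → Fin n) (ι-involutive : ∀ a → ι (ι a) ≡ a) where

  open FreeGroup ι ι-involutive

  private
    Word = List (Fin n)
    module SetEq = Setoid ([ set ]-Equality Word)

  infixr 7 _∙_
  infix 4 _≈_

  _∙_ : FIMraw ι → FIMraw ι → FIMraw ι
  _∙_ = _·_ ι

  _≈_ : FIMraw ι → FIMraw ι → Set
  _≈_ = _≈F_ ι

  ≈-intro : ∀ {P Q : List Word} {g h} → P ∼[ set ] Q → g ≡ h → (P , g) ≈ (Q , h)
  ≈-intro P∼Q g≡h = (λ _ → P∼Q) , g≡h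

  ≈-set : ∀ {e f} → e ≈ f → proj₁ e ∼[ set ] proj₁ f
  ≈-set (P∼Q , _) {w} = P∼Q w

  ≈-setoid : Setoid _ _
  ≈-setoid = record
    { Carrier       = FIMraw ι
    ; _≈_           = _≈_
    ; isEquivalence = record
      { refl  = ≈-intro SetEq.refl refl
      ; sym   = λ e≈f → ≈-intro (SetEq.sym (≈-set e≈f)) (sym (proj₂ e≈f))
      ; trans = λ e≈f f≈h →
          ≈-intro (SetEq.trans (≈-set e≈f) (≈-set f≈h)) (trans (proj₂ e≈f) (proj₂ f≈h))
      }
    }

  open Setoid ≈-setoid public
    using () renaming (refl to ≈-refl; sym to ≈-sym; trans to ≈-trans; reflexive to ≡⇒≈)

  ∙-assoc : ∀ e f h → e ∙ (f ∙ h) ≡ (e ∙ f) ∙ h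
  ∙-assoc (P , g) (Q , h) (S , k) = cong₂ _,_ sets (red-assoc g h k)
    where
    open ≡-Reasoning
    sets : P ++ map (λ q → red ι (g ++ q)) (Q ++ map (λ s → red ι (h ++ s)) S)
         ≡ (P ++ map (λ q → red ι (g ++ q)) Q) ++ map (λ s → red ι (red ι (g ++ h) ++ s)) S
    sets = begin
      P ++ map (λ q → red ι (g ++ q)) (Q ++ map (λ s → red ι (h ++ s)) S)
        ≡⟨ cong (P ++_) (map-++ _ Q _) ⟩
      P ++ (map (λ q → red ι (g ++ q)) Q ++ map (λ q → red ι (g ++ q)) (map (λ s → red ι (h ++ s)) S))
        ≡⟨ cong (λ T → P ++ (map (λ q → red ι (g ++ q)) Q ++ T)) (sym (map-∘ S)) ⟩
      P ++ (map (λ q → red ι (g ++ q)) Q ++ map (λ s → red ι (g ++ red ι (h ++ s))) S)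
        ≡⟨ cong (λ T → P ++ (map (λ q → red ι (g ++ q)) Q ++ T)) (map-cong (red-assoc g h) S) ⟩
      P ++ (map (λ q → red ι (g ++ q)) Q ++ map (λ s → red ι (red ι (g ++ h) ++ s)) S)
        ≡⟨ sym (++-assoc P _ _) ⟩
      (P ++ map (λ q → red ι (g ++ q)) Q) ++ map (λ s → red ι (red ι (g ++ h) ++ s)) S
        ∎

  ∙-cong : ∀ {e e′ f f′} → e ≈ e′ → f ≈ f′ → e ∙ f ≈ e′ ∙ f′
  ∙-cong e≈e′ f≈f′ = ≈-intro
    (SetEquality.++-cong (≈-set e≈e′)
      (SetEquality.map-cong (λ q → cong (λ g → red ι (g ++ q)) (proj₂ e≈e′)) (≈-set f≈f′)))
    (cong₂ (λ g h → red ι (g ++ h)) (proj₂ e≈e′) (proj₂ f≈f′))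

  invF-cong : ∀ {e f} → e ≈ f → invF ι e ≈ invF ι f
  invF-cong e≈f = ≈-intro
    (SetEquality.map-cong (λ p → cong (λ g → red ι (barW ι g ++ p)) (proj₂ e≈f)) (≈-set e≈f))
    (cong (barW ι) (proj₂ e≈f))

  ψ-reduced : ∀ {w} → Reduced ι w → ψ ι w ≈ (inits w , w)
  ψ-reduced {[]}    _ = ≈-refl
  ψ-reduced {a ∷ w} r = begin
    ψ₁ ι a ∙ ψ ι w
      ≈⟨ ∙-cong {ψ₁ ι a} ≈-refl (ψ-reduced (Reduced-tail r)) ⟩
    ψ₁ ι a ∙ (inits w , w)
      ≡⟨ cong₂ (λ P g → ([] ∷ (a ∷ []) ∷ P) , g) (map-cong-local prefixes-fixed) (red-id r) ⟩
    ([] ∷ (a ∷ []) ∷ map (a ∷_) (inits w)) , a ∷ w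
      ≈⟨ ≈-intro (SetEquality.∷-cong refl ∷-dup) refl ⟩
    inits (a ∷ w) , a ∷ w
      ∎
    where
    open import Relation.Binary.Reasoning.Setoid ≈-setoid
    prefixes-fixed : All (λ q → red ι (a ∷ q) ≡ a ∷ q) (inits w)
    prefixes-fixed = All.map red-id (All.map⁻ {xs = inits w} (All.tail (inits-reduced r)))

  -- s, z, x play σ(X), σ′(Z_X), σ′(x_X): τ(X) = Z_X x_X and τ(X̄) = x̄_X Z_X
  Splits : FIMraw ι → FIMraw ι → FIMraw ι → Set
  Splits s z x = z ∙ x ≈ s × invF ι x ∙ z ≈ invF ι s

  Splits-resp-≈ : ∀ {s s′ z x} → s ≈ s′ → Splits s z x → Splits s′ z x
  Splits-resp-≈ s≈s′ (zx≈s , x⁻¹z≈s⁻¹) = ≈-trans zx≈s s≈s′ , ≈-trans x⁻¹z≈s⁻¹ (invF-cong s≈s′)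

  splits : ∀ {P g z x} → Reduced ι g → z ≈ (P , []) → x ≈ (inits g , g) → Splits (P ++ inits g , g) z x
  splits {P} {g} r z≈ x≈ =
    ≈-trans (∙-cong z≈ x≈) (≡⇒≈ unit∙prefixes) ,
    ≈-trans (∙-cong (invF-cong x≈) z≈) (≈-intro prefixes⁻¹∙unit (red-barW r))
    where
    unit∙prefixes : (P , []) ∙ (inits g , g) ≡ (P ++ inits g , g)
    unit∙prefixes = cong₂ _,_ (cong (P ++_) (map-id-local (All.map red-id (inits-reduced r)))) (red-id r)
    ginv : Word → Word
    ginv p = red ι (barW ι g ++ p)
    prefixes⁻¹∙unit : (map ginv (inits g) ++ map ginv P) ∼[ set ] map ginv (P ++ inits g)
    prefixes⁻¹∙unit = SetEq.trans
      (CommutativeMonoid.comm (commutativeMonoid set Word) (map ginv (inits g)) (map ginv P))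
      (SetEq.reflexive (sym (map-++ ginv P (inits g))))

  evalT-τ : ∀ {m} {σ z x : Fin m → FIMraw ι} → (∀ i → Splits (σ i) (z i) (x i))
          → ∀ U → evalT ι z x (τ U) ≈ evalU ι σ U
  evalT-τ split []           = ≈-refl
  evalT-τ split (ltr a ∷ U)  = ∙-cong {ψ₁ ι a} ≈-refl (evalT-τ split U)
  evalT-τ {z = z} {x} split (var i ∷ U) =
    ≈-trans (≡⇒≈ (∙-assoc (z i) (x i) _)) (∙-cong (proj₁ (split i)) (evalT-τ split U))
  evalT-τ {z = z} {x} split (varᵇ i ∷ U) =
    ≈-trans (≡⇒≈ (∙-assoc (invF ι (x i)) (z i) _)) (∙-cong (proj₂ (split i)) (evalT-τ split U))

  Valid-resp-≈ : ∀ {e f} → e ≈ f → Valid ι e → Valid ι f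
  Valid-resp-≈ {P , g} {Q , .g} (P⇔Q , refl) (allP , closedP , g∈P) =
    All-resp-⊇ (from (P⇔Q _)) allP ,
    (λ u v uv∈Q → to (P⇔Q u) (closedP u v (from (P⇔Q _) uv∈Q))) ,
    to (P⇔Q g) g∈P
    where open Equivalence

  Valid-++ : ∀ {P Q g h} → Valid ι (P , g) → Valid ι (Q , h) → Valid ι (P ++ Q , h)
  Valid-++ {P} (allP , closedP , _) (allQ , closedQ , h∈Q) =
    All.++⁺ allP allQ , PrefixClosed-++ closedP closedQ , ∈-++⁺ʳ P h∈Q

  Valid-inits : ∀ {g} → Reduced ι g → Valid ι (inits g , g)
  Valid-inits {g} r = inits-reduced r , inits-prefixClosed g , ∈-inits-self g

  Valid-unitPart : ∀ {P g} → Valid ι (P , g) → Valid ι (P , [])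
  Valid-unitPart {g = g} (allP , closedP , g∈P) = allP , closedP , closedP [] g g∈P

  unitPart-idempotent : ∀ {P} → All (Reduced ι) P → Idempotent ι (P , [])
  unitPart-idempotent {P} allP = ≈-intro
    (SetEq.trans (SetEq.reflexive (cong (P ++_) (map-id-local (All.map red-id allP)))) (++-idempotent P))
    refl

  Valid⇒++inits≈ : ∀ {P g} → Valid ι (P , g) → (P ++ inits g , g) ≈ (P , g)
  Valid⇒++inits≈ (_ , closedP , g∈P) = ≈-intro (++-absorbʳ (inits-⊆ closedP g∈P)) refl

  ≈ψ⇒≡ : ∀ {x g w} → Reduced ι w → x ≈ (inits g , g) → x ≈ ψ ι w → g ≡ w
  ≈ψ⇒≡ r x≈g x≈ψw = trans (sym (proj₂ x≈g)) (trans (proj₂ x≈ψw) (proj₂ (ψ-reduced r)))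

module Solutions {n m : ℕ} (ι : Fin n → Fin n) (ι-involutive : ∀ a → ι (ι a) ≡ a)
                 (U V : List (Letter n m)) where

  open FreeInverseMonoid ι ι-involutive

  untyped⇒typed : (σ : Fin m → FIMraw ι) → UntypedSolution ι σ U V
    → TypedSolution ι (λ i → proj₁ (σ i) , []) (λ i → inits (proj₂ (σ i)) , proj₂ (σ i)) (τ U) (τ V)
  untyped⇒typed σ (valid , U≈V) =
    (λ i → Valid-unitPart (valid i)) ,
    (λ i → unitPart-idempotent (proj₁ (valid i))) ,
    (λ i → proj₂ (σ i) , g-reduced i , ≈-sym (ψ-reduced (g-reduced i))) ,
    ≈-trans (evalT-τ split U) (≈-trans U≈V (≈-sym (evalT-τ split V)))
    where
    g-reduced : ∀ i → Reduced ι (proj₂ (σ i))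
    g-reduced i = All.lookup (proj₁ (valid i)) (proj₂ (proj₂ (valid i)))
    z x : Fin m → FIMraw ι
    z i = proj₁ (σ i) , []
    x i = inits (proj₂ (σ i)) , proj₂ (σ i)
    split : ∀ i → Splits (σ i) (z i) (x i)
    split i = Splits-resp-≈ {z = z i} {x i} (Valid⇒++inits≈ (valid i))
                            (splits {z = z i} {x i} (g-reduced i) ≈-refl ≈-refl)

  typed⇒untyped : (z x : Fin m → FIMraw ι) → TypedSolution ι z x (τ U) (τ V)
    → (P : Fin m → List (List (Fin n))) (g : Fin m → List (Fin n))
    → (∀ i → z i ≈ (P i , []))
    → (∀ i → x i ≈ (inits (g i) , g i))
    → UntypedSolution ι (λ i → (P i ++ inits (g i)) , g i) U V
  typed⇒untyped z x (z-valid , _ , x-reduced , τU≈τV) P g z≈ x≈ =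
    (λ i → Valid-++ (Valid-resp-≈ (z≈ i) (z-valid i)) (Valid-inits (g-reduced i))) ,
    ≈-trans (≈-sym (evalT-τ split U)) (≈-trans τU≈τV (evalT-τ split V))
    where
    g-reduced : ∀ i → Reduced ι (g i)
    g-reduced i with x-reduced i
    ... | w , w-reduced , x≈ψw = subst (Reduced ι) (sym (≈ψ⇒≡ w-reduced (x≈ i) x≈ψw)) w-reduced
    split : ∀ i → Splits ((P i ++ inits (g i)) , g i) (z i) (x i)
    split i = splits (g-reduced i) (z≈ i) (x≈ i)

lemma4p1 : (n m : ℕ) (ι : Fin n → Fin n) → (∀ a → ι (ι a) ≡ a)
    → (U V : List (Letter n m))
    → ((σ : Fin m → FIMraw ι) → UntypedSolution ι σ U V
        → TypedSolution ι (λ i → proj₁ (σ i) , [])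
                          (λ i → inits (proj₂ (σ i)) , proj₂ (σ i))
                          (τ U) (τ V))
      × ((z x : Fin m → FIMraw ι) → TypedSolution ι z x (τ U) (τ V)
        → (P : Fin m → List (List (Fin n))) (g : Fin m → List (Fin n))
        → (∀ i → _≈F_ ι (z i) (P i , []))
        → (∀ i → _≈F_ ι (x i) (inits (g i) , g i))
        → UntypedSolution ι (λ i → (P i ++ inits (g i)) , g i) U V)
lemma4p1 n m ι ι-involutive U V = untyped⇒typed , typed⇒untyped
  where open Solutions ι ι-involutive U V
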